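{- Let $\Lambda$ be a finite set, let $\mathcal{A}$ be a point based function array over a semigroup $A$ indexed by $\Lambda$, and let $\mathcal{S}$ be a function array over a partial semigroup $S$ indexed by $\Lambda$ and based on a set $X$. Let $(f,g)\colon \mathcal{A}\to\gamma\mathcal{S}$ be a homomorphism. Then for each $D\in f(\bullet)$ and each coloring of $S$ with finitely many colors, there exists a basic sequence $(x_n)$ in $\mathcal{S}$ of elements of $D$ on which the coloring is $\mathcal{A}$-tame.
   Context: A partial semigroup is a set $S$ with a partially defined binary operation such that for all $r,s,t$, if one of $(rs)t$, $r(st)$ is defined then so is the other and they are equal. A function array over $S$ indexed by $\Lambda$ and based on $X$ assigns to each $\lambda\in\Lambda$ a partial function $\lambda$ from $X$ to $S$ such that for all $s_0,\dots,s_k\in S$ there is $x\in X$ with $s_i\lambda(x)$ defined for all $i\leq k$ and all $\lambda\in\Lambda$. It is total if $S$ is a semigroup and each $\lambda$ is defined on all of $X$; point based if $X=\{\bullet\}$. For $S$ directed, $\gamma S$ is the set of ultrafilters $\mathcal{U}$ on $S$ with $\{t: st \text{ defined}\}\in\mathcal{U}$ for all $s\in S$, with operation $B\in\mathcal{U}*\mathcal{V}$ iff $\{s : \{t : st\text{ defined and } st\in B\}\in\mathcal{V}\}\in\mathcal{U}$ (a compact right topological semigroup with the Čech–Stone topology). $\gamma X$ is the set of ultrafilters $\mathcal{U}$ on $X$ with $\{x: s\lambda(x)\text{ defined}\}\in\mathcal{U}$ for all $s\in S,\lambda\in\Lambda$; each $\lambda$ extends to $\lambda\colon\gamma X\to\gamma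 S$ by $B\in\lambda(\mathcal{U})$ iff $\lambda^{ -1}(B)\in\mathcal{U}$; this gives the total function array $\gamma\mathcal{S}$ over $\gamma S$ indexed by $\Lambda$ based on $\gamma X$. For total function arrays $\mathcal{A}$ (over $A$, based on $Y$) and $\mathcal{B}$ (over $B$, based on $Z$) indexed by $\Lambda$, a homomorphism is a pair $(f,g)$ with $f\colon Y\to Z$, $g\colon A\to B$ a semigroup homomorphism, and $\lambda(f(y))=g(\lambda(y))$ for all $y,\lambda$. A sequence $(x_n)$ in $X$ is basic in $\mathcal{S}$ if for all $n_0<\dots<n_l$ and $\lambda_0,\dots,\lambda_l\in\Lambda$ the product $\lambda_0(x_{n_0})\cdots\lambda_l(x_{n_l})$ is defined in $S$. Writing $\vee$ for the operation of $A$ and $\Lambda(\bullet)=\{\lambda(\bullet):\lambda\in\Lambda\}$, a coloring of $S$ is $\mathcal{A}$-tame on a basic $(x_n)$ if the color of $\lambda_0(x_{n_0})\cdots\lambda_l(x_{n_l})$ ($n_0<\dots<n_l$), among those with $\lambda_k(\bullet)\vee\cdots\vee\lambda_l(\bullet)\in\Lambda(\bullet)$ for each $k\leq l$, depends only on $\lambda_0(\bullet)\vee\cdots\vee\lambda_l(\bullet)\in A$. -}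

module Defs where

open import Data.Bool using (Bool; true; false; not; _∧_)
open import Data.Nat using (ℕ; _<_)
open import Data.Fin using (Fin)
open import Data.Maybe using (Maybe; just; nothing; is-just; maybe′; _>>=_; map)
open import Data.List using (List; []; _∷_)
open import Data.List.Relation.Unary.All using (All)
open import Data.List.Relation.Unary.Linked using (Linked)
open import Data.Product using (Σ; ∃; _×_; _,_; proj₁; proj₂)
open import Data.Unit using (⊤)
open import Algebra.Definitions using (Associative)
open import Relation.Binary.PropositionalEquality using (_≡_)

-- Subsets of a set are represented as Bool-valued predicates X → Bool
-- (classically the same thing as arbitrary subsets).

record IsUltrafilter {X : Set} (U : (X → Bool) → Bool) : Set where
  field
    whole    : U (λ _ → true) ≡ true
    upward   : ∀ (B C : X → Bool) → (∀ x → B x ≡ true → C x ≡ true) →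
               U B ≡ true → U C ≡ true
    inter    : ∀ (B C : X → Bool) → U B ≡ true → U C ≡ true →
               U (λ x → B x ∧ C x) ≡ true
    -- proper: every member of U is nonempty (constructive form of ∅ ∉ U)
    nonempty : ∀ (B : X → Bool) → U B ≡ true → Σ X (λ x → B x ≡ true)
    ultra    : ∀ (B : X → Bool) → U B ≡ false → U (λ x → not (B x)) ≡ true

_≈U_ : {X : Set} → ((X → Bool) → Bool) → ((X → Bool) → Bool) → Set
U ≈U V = ∀ B → U B ≡ V B

-- Partial semigroups: the partial operation is S → S → Maybe S.
-- Associativity: (rs)t defined iff r(st) defined, and then equal,
-- i.e. the two Maybe-values coincide.

record PartialSemigroup : Set₁ where
  field
    Carrier : Set
    _·_     : Carrier → Carrier → Maybe Carrier
    assoc   : ∀ r s t → ((r · s) >>= λ u → u · t) ≡ ((s · t) >>= λ v → r · v)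

record TotalSemigroup : Set₁ where
  field
    Carrier : Set
    _∨_     : Carrier → Carrier → Carrier
    assoc   : Associative _≡_ _∨_

-- Function arrays over a partial semigroup S indexed by Λ = Fin m,
-- based on X: each λ is a partial function X → S (X → Maybe S).

module _ (P : PartialSemigroup) where
  open PartialSemigroup P renaming (Carrier to S)

  defdAt : {X : Set} → (X → Maybe S) → S → X → Bool
  defdAt fl s x = is-just (fl x >>= λ a → s · a)

  record FunctionArray (m : ℕ) (X : Set) : Set where
    field
      fn   : Fin m → X → Maybe S
      cond : ∀ (s : S) (ss : List S) →
             Σ X (λ x → All (λ t → ∀ l → defdAt (fn l) t x ≡ true) (s ∷ ss))

  InGammaS : ((S → Bool) → Bool) → Set
  InGammaS U = IsUltrafilter U × (∀ s → U (λ t → is-just (s · t)) ≡ true)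

  GammaS : Set
  GammaS = Σ ((S → Bool) → Bool) InGammaS

  _⊛_ : ((S → Bool) → Bool) → ((S → Bool) → Bool) → ((S → Bool) → Bool)
  (U ⊛ V) B = U (λ s → V (λ t → maybe′ B false (s · t)))

  module _ {m : ℕ} {X : Set} (𝒮 : FunctionArray m X) where
    open FunctionArray 𝒮

    InGammaX : ((X → Bool) → Bool) → Set
    InGammaX U = IsUltrafilter U × (∀ s l → U (defdAt (fn l) s) ≡ true)

    extend : Fin m → ((X → Bool) → Bool) → ((S → Bool) → Bool)
    extend l U B = U (λ x → maybe′ B false (fn l x))

    -- Homomorphism (f , g) from a point based function array over the
    -- semigroup A (given by ε : Λ → A, ε λ = λ(•)) to γ𝒮.
    record Homomorphism (A : TotalSemigroup) (ε : Fin m → TotalSemigroup.Carrier A) : Set where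
      open TotalSemigroup A renaming (Carrier to Ac)
      field
        f     : (X → Bool) → Bool
        f∈γX  : InGammaX f
        g     : Ac → (S → Bool) → Bool
        g∈γS  : ∀ a → InGammaS (g a)
        g-hom : ∀ a b → g (a ∨ b) ≈U (g a ⊛ g b)
        comm  : ∀ l → extend l f ≈U g (ε l)

    -- Words λ₀(x_{n₀}) ⋯ λ_l(x_{n_l}): a nonempty list of pairs (nᵢ , λᵢ)
    -- given as head p and tail ps, with n₀ < ⋯ < n_l.

    Increasing : (ℕ × Fin m) → List (ℕ × Fin m) → Set
    Increasing p ps = Linked (λ a b → proj₁ a < proj₁ b) (p ∷ ps)

    -- the product λ₀(x_{n₀}) ⋯ λ_l(x_{n_l}) (bracketing is irrelevant by
    -- associativity; here bracketed to the right)
    word : (ℕ → X) → (ℕ × Fin m) → List (ℕ × Fin m) → Maybe S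
    word x (n , l) []       = fn l (x n)
    word x (n , l) (q ∷ qs) = fn l (x n) >>= λ a → word x q qs >>= λ b → a · b

    Basic : (ℕ → X) → Set
    Basic x = ∀ p ps → Increasing p ps → is-just (word x p ps) ≡ true

    module _ (A : TotalSemigroup) (ε : Fin m → TotalSemigroup.Carrier A) where
      open TotalSemigroup A renaming (Carrier to Ac)

      joinA : (ℕ × Fin m) → List (ℕ × Fin m) → Ac
      joinA (n , l) []       = ε l
      joinA (n , l) (q ∷ qs) = ε l ∨ joinA q qs

      SuffixOK : (ℕ × Fin m) → List (ℕ × Fin m) → Set
      SuffixOK p []       = ∃ λ μ → joinA p [] ≡ ε μ
      SuffixOK p (q ∷ qs) = (∃ λ μ → joinA p (q ∷ qs) ≡ ε μ) × SuffixOK q qs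

      Tame : {k : ℕ} → (S → Fin k) → (ℕ → X) → Set
      Tame c x = ∀ p ps p′ ps′ →
        Increasing p ps → SuffixOK p ps →
        Increasing p′ ps′ → SuffixOK p′ ps′ →
        joinA p ps ≡ joinA p′ ps′ →
        map c (word x p ps) ≡ map c (word x p′ ps′)

-- The sequence is chosen greedily: x n lies in a set of the ultrafilter f(•)
-- forcing each λ(x n) into every set that g(λ(•)) demands of it.  For each μ we
-- also keep a set target n μ ∈ g(μ(•)) shrinking with n.  As (f , g) commutes
-- with the letters and g is a homomorphism into γS, B ∈ g(λ(•) ∨ μ(•)) means
-- {a : a⁻¹B ∈ g(μ(•))} ∈ g(λ(•)), so λ(x n) can be put into that set; shrinking
-- the targets by the resulting sets a⁻¹B makes every word whose suffix joins are
-- letters and whose join is ν(•) land in the initial target of ν.  Initial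
-- targets that are colour classes in g(ν(•)) give tameness, and a growing list of
-- pending partial products keeps every word defined.
module Submission where

open import Defs
open import Data.Bool using (Bool; true; false; not; _∧_; _∨_)
open import Data.Bool.Properties using (∧-conicalˡ; ∧-conicalʳ) renaming (_≟_ to _≟ᵇ_)
open import Data.Nat using (ℕ; zero; suc; z≤n; _≤′_; ≤′-refl; ≤′-step)
open import Data.Nat.Properties using (≤⇒≤′)
open import Data.Fin using (Fin; _≟_)
open import Data.Maybe using (Maybe; just; maybe′; _>>=_; is-just)
import Data.Maybe as Maybe
import Data.Maybe.Relation.Unary.Any as MaybeAny
open import Data.List
  using (List; []; _∷_; _++_; map; filter; mapMaybe; allFin; cartesianProduct; cartesianProductWith)
open import Data.List.Membership.Propositional using (_∈_)
open import Data.List.Membership.Propositional.Properties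
  using ( ∈-++⁺ˡ; ∈-++⁺ʳ; ∈-map⁺; ∈-filter⁺; ∈-filter⁻; ∈-allFin
        ; ∈-cartesianProduct⁺; ∈-cartesianProductWith⁺)
open import Data.List.Relation.Binary.Subset.Propositional using (_⊆_)
open import Data.List.Relation.Unary.Any as Any using (Any; here; there)
open import Data.List.Relation.Unary.Any.Properties using (map⁺; map⁻; mapMaybe⁺)
open import Data.List.Relation.Unary.Linked using (_∷_)
open import Data.Product using (Σ; ∃; _×_; _,_; proj₁; proj₂; uncurry)
open import Relation.Nullary using (does; yes)
open import Relation.Nullary.Decidable using (dec-true)
open import Relation.Binary.PropositionalEquality using (_≡_; refl; sym; trans; cong; subst)

∈-mapMaybe⁺ : {A B : Set} {f : A → Maybe B} {x : A} {y : B} (xs : List A) →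
              x ∈ xs → f x ≡ just y → y ∈ mapMaybe f xs
∈-mapMaybe⁺ {f = f} {y = y} xs x∈xs fx≡y =
  mapMaybe⁺ f xs (map⁺ (Any.map (λ { refl → fx∈ }) x∈xs))
  where
  fx∈ : MaybeAny.Any (y ≡_) (f _)
  fx∈ = subst (MaybeAny.Any (y ≡_)) (sym fx≡y) (MaybeAny.just refl)

maybe′-≡true : {A : Set} {B : A → Bool} (ma : Maybe A) →
               maybe′ B false ma ≡ true → ∃ λ a → ma ≡ just a × B a ≡ true
maybe′-≡true (just a) Ba = a , refl , Ba

is-just⇒≡just : {A : Set} (ma : Maybe A) → is-just ma ≡ true → ∃ λ a → ma ≡ just a
is-just⇒≡just (just a) _ = a , refl

module _ {Y : Set} where

  ⋂ : List (Y → Bool) → Y → Bool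
  ⋂ []       y = true
  ⋂ (B ∷ Bs) y = B y ∧ ⋂ Bs y

  ⋂-⊆ : ∀ {Bs B y} → ⋂ Bs y ≡ true → B ∈ Bs → B y ≡ true
  ⋂-⊆ {B′ ∷ Bs} {y = y} ∈⋂ (here refl) = ∧-conicalˡ (B′ y) (⋂ Bs y) ∈⋂
  ⋂-⊆ {B′ ∷ Bs} {y = y} ∈⋂ (there B∈) = ⋂-⊆ (∧-conicalʳ (B′ y) (⋂ Bs y) ∈⋂) B∈

  ⋂⟨_⟩_ : ((Y → Bool) → Bool) → List (Y → Bool) → Y → Bool
  ⋂⟨ U ⟩ Bs = ⋂ (filter (λ B → U B ≟ᵇ true) Bs)

  ⋂⟨⟩-⊆ : ∀ U Bs {B y} → (⋂⟨ U ⟩ Bs) y ≡ true → B ∈ Bs → U B ≡ true → B y ≡ true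
  ⋂⟨⟩-⊆ U _ ∈⋂ B∈ B∈U = ⋂-⊆ ∈⋂ (∈-filter⁺ (λ B → U B ≟ᵇ true) B∈ B∈U)

  ⋃ : List (Y → Bool) → Y → Bool
  ⋃ []       y = false
  ⋃ (B ∷ Bs) y = B y ∨ ⋃ Bs y

  ⋃-⊇ : ∀ {Bs B y} → B ∈ Bs → B y ≡ true → ⋃ Bs y ≡ true
  ⋃-⊇ (here refl) By rewrite By = refl
  ⋃-⊇ {B′ ∷ Bs} {y = y} (there B∈) By with B′ y
  ... | true  = refl
  ... | false = ⋃-⊇ B∈ By

  colourClass : {k : ℕ} → (Y → Fin k) → Fin k → Y → Bool
  colourClass c i y = does (c y ≟ i)

  colourClass-sound : ∀ {k} {c : Y → Fin k} {i y} → colourClass c i y ≡ true → c y ≡ i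
  colourClass-sound {c = c} {i} {y} ∈class with c y ≟ i
  ... | yes cy≡i = cy≡i

module Ultrafilter {Y : Set} {U : (Y → Bool) → Bool} (isU : IsUltrafilter U) where
  open IsUltrafilter isU

  ⋂-∈ : ∀ Bs → (∀ {B} → B ∈ Bs → U B ≡ true) → U (⋂ Bs) ≡ true
  ⋂-∈ []       _    = whole
  ⋂-∈ (B ∷ Bs) all∈ = inter B (⋂ Bs) (all∈ (here refl)) (⋂-∈ Bs (λ B∈ → all∈ (there B∈)))

  ⋂⟨⟩-∈ : ∀ Bs → U (⋂⟨ U ⟩ Bs) ≡ true
  ⋂⟨⟩-∈ Bs = ⋂-∈ (filter (λ B → U B ≟ᵇ true) Bs)
    (λ B∈ → proj₂ (∈-filter⁻ (λ B → U B ≟ᵇ true) {xs = Bs} B∈))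

  ⋃-∈⁻ : ∀ Bs → U (⋃ Bs) ≡ true → Any (λ B → U B ≡ true) Bs
  ⋃-∈⁻ [] ∅∈U with () ← proj₂ (nonempty _ ∅∈U)
  ⋃-∈⁻ (B ∷ Bs) ∪∈U with U B in B∈U
  ... | true  = here B∈U
  ... | false = there (⋃-∈⁻ Bs (upward _ _ rest (inter _ _ (ultra B B∈U) ∪∈U)))
    where
    rest : ∀ y → not (B y) ∧ (B y ∨ ⋃ Bs y) ≡ true → ⋃ Bs y ≡ true
    rest y with B y
    ... | false = λ ∈rest → ∈rest

  colourClass-∈ : ∀ {k} (c : Y → Fin k) → ∃ λ i → U (colourClass c i) ≡ true
  colourClass-∈ {k} c =
    Any.satisfied (map⁻ (⋃-∈⁻ (map (colourClass c) (allFin k)) (upward _ _ covered whole)))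
    where
    covered : ∀ y → true ≡ true → ⋃ (map (colourClass c) (allFin k)) y ≡ true
    covered y _ = ⋃-⊇ (∈-map⁺ (colourClass c) (∈-allFin (c y))) (dec-true (c y ≟ c y) refl)

module PartialSemigroupProperties (P : PartialSemigroup) where
  open PartialSemigroup P renaming (Carrier to S)

  _⁻¹·_ : S → (S → Bool) → S → Bool
  (a ⁻¹· B) t = maybe′ B false (a · t)

  -- The ultrafilter product of Defs reads  (U ⊛ V) B = U (leftFactors V B).
  leftFactors : ((S → Bool) → Bool) → (S → Bool) → S → Bool
  leftFactors V B a = V (a ⁻¹· B)

  ·-reassoc : ∀ {r s t rs st} → r · s ≡ just rs → s · t ≡ just st → rs · t ≡ r · st
  ·-reassoc {r} {s} {t} rs≡ st≡ =
    trans (cong (_>>= λ u → u · t) (sym rs≡)) (trans (assoc r s t) (cong (_>>= λ v → r · v) st≡))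

module Construction
    {m : ℕ} {A : TotalSemigroup} {ε : Fin m → TotalSemigroup.Carrier A}
    {P : PartialSemigroup} {X : Set} {𝒮 : FunctionArray P m X}
    (h : Homomorphism P 𝒮 A ε)
    (D : X → Bool) (D∈f : Homomorphism.f h D ≡ true)
    (T₀ : Fin m → PartialSemigroup.Carrier P → Bool)
    (T₀∈g : ∀ ν → Homomorphism.g h (ε ν) (T₀ ν) ≡ true) where

  open PartialSemigroup P renaming (Carrier to S)
  open PartialSemigroupProperties P
  open TotalSemigroup A using () renaming (_∨_ to _⊔_)
  open FunctionArray 𝒮 using (fn)
  open Homomorphism h
  open IsUltrafilter (proj₁ f∈γX) using (nonempty)

  g-ultra : ∀ a → IsUltrafilter (g a)
  g-ultra a = proj₁ (g∈γS a)

  preimage : Fin m → (S → Bool) → X → Bool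
  preimage l R x = maybe′ R false (fn l x)

  record Stage : Set where
    field
      pending  : List S
      target   : Fin m → S → Bool
      target∈g : ∀ ν → g (ε ν) (target ν) ≡ true
  open Stage

  -- The sets into which λ(x) must fall whenever g(λ(•)) contains them.
  requests : Stage → List (S → Bool)
  requests s = (λ _ → true)
    ∷ map (target s) (allFin m)
    ++ cartesianProductWith (λ μ ν → leftFactors (g (ε μ)) (target s ν)) (allFin m) (allFin m)
    ++ map (λ t a → is-just (t · a)) (pending s)

  demands : Stage → List (X → Bool)
  demands s = D ∷ cartesianProductWith preimage (allFin m) (requests s)

  admissible : Stage → X → Bool
  admissible s = ⋂⟨ f ⟩ demands s

  admissible-nonempty : ∀ s → Σ X (λ x → admissible s x ≡ true)
  admissible-nonempty s = nonempty (admissible s) (Ultrafilter.⋂⟨⟩-∈ (proj₁ f∈γX) (demands s))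

  choose : Stage → X
  choose s = proj₁ (admissible-nonempty s)

  choose-∈D : ∀ s → D (choose s) ≡ true
  choose-∈D s = ⋂⟨⟩-⊆ f (demands s) (proj₂ (admissible-nonempty s)) (here refl) D∈f

  letter : ∀ s l → ∃ λ a → fn l (choose s) ≡ just a ×
           (∀ {R} → R ∈ requests s → g (ε l) R ≡ true → R a ≡ true)
  letter s l =
    let a , fn≡a , _ = maybe′-≡true (fn l (choose s))
                         (lands (here refl) (IsUltrafilter.whole (g-ultra (ε l))))
    in a , fn≡a , λ R∈ R∈g → subst (λ ma → maybe′ _ false ma ≡ true) fn≡a (lands R∈ R∈g)
    where
    lands : ∀ {R} → R ∈ requests s → g (ε l) R ≡ true → preimage l R (choose s) ≡ true
    lands R∈ R∈g = ⋂⟨⟩-⊆ f (demands s) (proj₂ (admissible-nonempty s))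
      (there (∈-cartesianProductWith⁺ preimage (∈-allFin l) R∈)) (trans (comm l _) R∈g)

  letter-∈target : ∀ s l {ν} → g (ε l) (target s ν) ≡ true → target s ν (proj₁ (letter s l)) ≡ true
  letter-∈target s l {ν} =
    proj₂ (proj₂ (letter s l)) (there (∈-++⁺ˡ (∈-map⁺ (target s) (∈-allFin ν))))

  letter-∈leftFactors : ∀ s l {μ ν} → g (ε l) (leftFactors (g (ε μ)) (target s ν)) ≡ true →
                        leftFactors (g (ε μ)) (target s ν) (proj₁ (letter s l)) ≡ true
  letter-∈leftFactors s l {μ} {ν} = proj₂ (proj₂ (letter s l))
    (there (∈-++⁺ʳ (map (target s) (allFin m)) (∈-++⁺ˡ
      (∈-cartesianProductWith⁺ (λ μ ν → leftFactors (g (ε μ)) (target s ν)) (∈-allFin μ) (∈-allFin ν)))))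

  letter-composable : ∀ s l {t} → t ∈ pending s → is-just (t · proj₁ (letter s l)) ≡ true
  letter-composable s l {t} t∈ = proj₂ (proj₂ (letter s l))
    (there (∈-++⁺ʳ (map (target s) (allFin m)) (∈-++⁺ʳ _ (∈-map⁺ (λ t a → is-just (t · a)) t∈))))
    (proj₂ (g∈γS (ε l)) t)

  letters : X → List S
  letters x = mapMaybe (λ l → fn l x) (allFin m)

  next : Stage → Stage
  next s = record
    { pending  = pending s ++ letters x ++ mapMaybe (uncurry _·_) (cartesianProduct (pending s) (letters x))
    ; target   = λ μ t → target s μ t ∧ (⋂⟨ g (ε μ) ⟩ translates) t
    ; target∈g = λ μ → IsUltrafilter.inter (g-ultra (ε μ)) _ _
                          (target∈g s μ) (Ultrafilter.⋂⟨⟩-∈ (g-ultra (ε μ)) translates)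
    }
    where
    x : X
    x = choose s
    translates : List (S → Bool)
    translates = cartesianProductWith (λ a ν → a ⁻¹· target s ν) (letters x) (allFin m)

  letter-∈letters : ∀ s l → proj₁ (letter s l) ∈ letters (choose s)
  letter-∈letters s l = ∈-mapMaybe⁺ (allFin m) (∈-allFin l) (proj₁ (proj₂ (letter s l)))

  letter-pending : ∀ s l → proj₁ (letter s l) ∈ pending (next s)
  letter-pending s l = ∈-++⁺ʳ (pending s) (∈-++⁺ˡ (letter-∈letters s l))

  product-pending : ∀ s l {t b} → t ∈ pending s → t · proj₁ (letter s l) ≡ just b → b ∈ pending (next s)
  product-pending s l t∈ ta≡b = ∈-++⁺ʳ (pending s) (∈-++⁺ʳ (letters (choose s))
    (∈-mapMaybe⁺ _ (∈-cartesianProduct⁺ t∈ (letter-∈letters s l)) ta≡b))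

  next-target : ∀ s l {μ ν t} → target (next s) μ t ≡ true →
                g (ε μ) (proj₁ (letter s l) ⁻¹· target s ν) ≡ true →
                (proj₁ (letter s l) ⁻¹· target s ν) t ≡ true
  next-target s l {μ} {ν} {t} t∈ = ⋂⟨⟩-⊆ (g (ε μ)) _ (∧-conicalʳ (target s μ t) _ t∈)
    (∈-cartesianProductWith⁺ (λ a ν → a ⁻¹· target s ν) (letter-∈letters s l) (∈-allFin ν))

  target∈g-at : ∀ s {a ν} → a ≡ ε ν → g a (target s ν) ≡ true
  target∈g-at s {ν = ν} refl = target∈g s ν

  initial : Stage
  initial = record { pending = [] ; target = T₀ ; target∈g = T₀∈g }

  stage : ℕ → Stage
  stage zero    = initial
  stage (suc n) = next (stage n)

  x : ℕ → X
  x n = choose (stage n)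

  pending-mono : ∀ {j k} → j ≤′ k → pending (stage j) ⊆ pending (stage k)
  pending-mono ≤′-refl         t∈ = t∈
  pending-mono (≤′-step j≤′k) t∈ = ∈-++⁺ˡ (pending-mono j≤′k t∈)

  target-anti : ∀ {j k} → j ≤′ k → ∀ {ν t} → target (stage k) ν t ≡ true → target (stage j) ν t ≡ true
  target-anti ≤′-refl         t∈ = t∈
  target-anti (≤′-step j≤′k) t∈ = target-anti j≤′k (∧-conicalˡ _ _ t∈)

  word-∷ : ∀ j l q qs {a t} → fn l (x j) ≡ just a → word P 𝒮 x q qs ≡ just t →
           word P 𝒮 x (j , l) (q ∷ qs) ≡ a · t
  word-∷ _ _ _ _ a≡ t≡ rewrite a≡ | t≡ = refl

  word-composable : ∀ p ps → Increasing P 𝒮 p ps →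
    ∃ λ t → word P 𝒮 x p ps ≡ just t ×
            (∀ {s} → s ∈ pending (stage (proj₁ p)) → is-just (s · t) ≡ true)
  word-composable (j , l) [] _ =
    proj₁ (letter (stage j) l) , proj₁ (proj₂ (letter (stage j) l)) , letter-composable (stage j) l
  word-composable (j , l) (q ∷ qs) (j<q ∷ inc) =
    let t , t≡ , t-composable = word-composable q qs inc
        a , a≡ , _ = letter (stage j) l
        u , at≡u = is-just⇒≡just (a · t) (t-composable (later (letter-pending (stage j) l)))
    in u , trans (word-∷ j l q qs a≡ t≡) at≡u , λ s∈ →
       let b , sa≡b = is-just⇒≡just _ (letter-composable (stage j) l s∈)
       in subst (λ v → is-just v ≡ true) (·-reassoc sa≡b at≡u)
                (t-composable (later (product-pending (stage j) l s∈ sa≡b)))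
    where
    later : pending (stage (suc j)) ⊆ pending (stage (proj₁ q))
    later = pending-mono (≤⇒≤′ j<q)

  SuffixOK-join : ∀ {p} ps → SuffixOK P 𝒮 A ε p ps → ∃ λ μ → joinA P 𝒮 A ε p ps ≡ ε μ
  SuffixOK-join []      ok = ok
  SuffixOK-join (_ ∷ _) ok = proj₁ ok

  word-∈target : ∀ p ps → Increasing P 𝒮 p ps → SuffixOK P 𝒮 A ε p ps →
    ∀ {ν} → joinA P 𝒮 A ε p ps ≡ ε ν →
    ∃ λ t → word P 𝒮 x p ps ≡ just t × target (stage (proj₁ p)) ν t ≡ true
  word-∈target (j , l) [] _ _ l≡ν =
    proj₁ (letter (stage j) l) , proj₁ (proj₂ (letter (stage j) l)) ,
    letter-∈target (stage j) l (target∈g-at (stage j) l≡ν)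
  word-∈target (j , l) (q ∷ qs) (j<q ∷ inc) (_ , ok) {ν} join≡ν =
    let μ , tail≡μ = SuffixOK-join qs ok
        t , t≡ , t∈ = word-∈target q qs inc ok tail≡μ
        a , a≡ , _ = letter (stage j) l
        a∈ = letter-∈leftFactors (stage j) l (trans (sym (g-hom (ε l) (ε μ) (target (stage j) ν)))
               (target∈g-at (stage j) (trans (cong (ε l ⊔_) (sym tail≡μ)) join≡ν)))
        u , at≡u , u∈ = maybe′-≡true (a · t)
                          (next-target (stage j) l (target-anti (≤⇒≤′ j<q) t∈) a∈)
    in u , trans (word-∷ j l q qs a≡ t≡) at≡u , u∈

  x-basic : Basic P 𝒮 x
  x-basic p ps inc = subst (λ w → is-just w ≡ true) (sym (proj₁ (proj₂ (word-composable p ps inc)))) refl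

  x-∈D : ∀ n → D (x n) ≡ true
  x-∈D n = choose-∈D (stage n)

  word-∈T₀ : ∀ {p ps ν} → Increasing P 𝒮 p ps → SuffixOK P 𝒮 A ε p ps →
             joinA P 𝒮 A ε p ps ≡ ε ν →
             ∃ λ t → word P 𝒮 x p ps ≡ just t × T₀ ν t ≡ true
  word-∈T₀ {p} {ps} inc ok join≡ν =
    let t , t≡ , t∈ = word-∈target p ps inc ok join≡ν
    in t , t≡ , target-anti (≤⇒≤′ (z≤n {proj₁ p})) t∈

theorem3p1 : (m : ℕ) (A : TotalSemigroup) (ε : Fin m → TotalSemigroup.Carrier A)
    (P : PartialSemigroup) (X : Set) (𝒮 : FunctionArray P m X)
    (h : Homomorphism P 𝒮 A ε)
    (D : X → Bool) → Homomorphism.f h D ≡ true →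
    (k : ℕ) (c : PartialSemigroup.Carrier P → Fin k) →
    Σ (ℕ → X) (λ x → Basic P 𝒮 x × (∀ n → D (x n) ≡ true) × Tame P 𝒮 A ε c x)
theorem3p1 m A ε P X 𝒮 h D D∈f k c = x , x-basic , x-∈D , tame
  where
  open Homomorphism h using (g; g∈γS)

  dominant : ∀ ν → ∃ λ i → g (ε ν) (colourClass c i) ≡ true
  dominant ν = Ultrafilter.colourClass-∈ (proj₁ (g∈γS (ε ν))) c

  open Construction h D D∈f (λ ν → colourClass c (proj₁ (dominant ν))) (λ ν → proj₂ (dominant ν))

  colour-of-word : ∀ {p ps μ} → Increasing P 𝒮 p ps → SuffixOK P 𝒮 A ε p ps →
                   joinA P 𝒮 A ε p ps ≡ ε μ →
                   Maybe.map c (word P 𝒮 x p ps) ≡ just (proj₁ (dominant μ))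
  colour-of-word inc ok join≡μ =
    let t , t≡ , t∈ = word-∈T₀ inc ok join≡μ
    in trans (cong (Maybe.map c) t≡) (cong just (colourClass-sound {c = c} t∈))

  tame : Tame P 𝒮 A ε c x
  tame p ps p′ ps′ inc ok inc′ ok′ same-join =
    let μ , join≡μ = SuffixOK-join ps ok
    in trans (colour-of-word inc ok join≡μ) (sym (colour-of-word inc′ ok′ (trans (sym same-join) join≡μ)))
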